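{- Let $k\geq 1$ and $d\geq 1$ be integers and let $c$ be an integer with $c\geq (2k-1)\lceil d/2\rceil+1$. If $D$ is a $c$-edge-connected directed graph with diameter $d$, then $D$ is $k$-edge-ordered.
   Context: Directed graphs are finite, without loops or multiple arcs. The diameter is the maximum, over ordered pairs $(u,v)$ of vertices, of the length of a shortest directed path from $u$ to $v$. An edge cut of $D$ is the set $[S,\bar S]$ of arcs from $S$ to its complement $\bar S$, for a nonempty proper subset $S$ of the vertices; $D$ is $c$-edge-connected if every edge cut has at least $c$ arcs. A directed tour is a closed directed walk with no repeated arcs. $D$ is $k$-edge-ordered if for every sequence $e_1,\ldots,e_k$ of $k$ distinct arcs of $D$ there is a directed tour containing $e_1,\ldots,e_k$ in this (cyclic) order. -}

module Defs where

open import Data.Nat using (ℕ; zero; suc; _+_; _<_; _≤_)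
open import Data.Bool using (Bool; true; false; if_then_else_; _∧_; not)
open import Data.Fin using (Fin)
open import Data.Fin.Subset using (Subset; Nonempty; ∁)
open import Data.List using (List; []; _∷_; map; allFin)
open import Data.Nat.ListAction using (sum)
open import Data.List.Relation.Unary.All using (All)
open import Data.List.Relation.Unary.Unique.Propositional using (Unique)
open import Data.Product using (_×_; _,_; proj₁; proj₂; ∃; ∃-syntax; Σ-syntax)
open import Data.Unit using (⊤)
open import Data.Vec using (lookup)
open import Relation.Binary.PropositionalEquality using (_≡_; _≢_)
open import Relation.Nullary using (¬_)

record Digraph : Set where
  field
    n        : ℕ
    adj      : Fin n → Fin n → Bool
    loopless : ∀ v → adj v v ≡ false
open Digraph public

Vertex : Digraph → Set
Vertex D = Fin (n D)

Pair : Digraph → Set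
Pair D = Vertex D × Vertex D

IsArc : (D : Digraph) → Pair D → Set
IsArc D (u , v) = adj D u v ≡ true

data Walk (D : Digraph) : Vertex D → Vertex D → ℕ → Set where
  nil  : ∀ {u} → Walk D u u zero
  cons : ∀ {u w v ℓ} → adj D u w ≡ true → Walk D w v ℓ → Walk D u v (suc ℓ)

-- dist(u,v) ≤ m  (shortest directed path = shortest directed walk)
DistAtMost : (D : Digraph) → Vertex D → Vertex D → ℕ → Set
DistAtMost D u v m = ∃[ ℓ ] (ℓ ≤ m × Walk D u v ℓ)

HasDiameter : Digraph → ℕ → Set
HasDiameter D d =
  (∀ u v → DistAtMost D u v d) ×
  (∃[ u ] ∃[ v ] (DistAtMost D u v d × (∀ ℓ → Walk D u v ℓ → d ≤ ℓ)))

cutSize : (D : Digraph) → Subset (n D) → ℕ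
cutSize D S =
  sum (map (λ u → sum (map (λ v →
        if lookup S u ∧ not (lookup S v) ∧ adj D u v then 1 else 0)
      (allFin (n D)))) (allFin (n D)))

EdgeConnected : Digraph → ℕ → Set
EdgeConnected D c =
  (S : Subset (n D)) → Nonempty S → Nonempty (∁ S) → c ≤ cutSize D S

Linked : {D : Digraph} → List (Pair D) → Set
Linked [] = ⊤
Linked (a ∷ []) = ⊤
Linked {D} (a ∷ b ∷ rest) = proj₂ a ≡ proj₁ b × Linked {D} (b ∷ rest)

lastArc : {D : Digraph} → Pair D → List (Pair D) → Pair D
lastArc a [] = a
lastArc {D} a (b ∷ rest) = lastArc {D} b rest

Closes : {D : Digraph} → List (Pair D) → Set
Closes [] = ⊤
Closes {D} (a ∷ rest) = proj₂ (lastArc {D} a rest) ≡ proj₁ a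

IsTour : (D : Digraph) → List (Pair D) → Set
IsTour D t = (t ≢ []) × All (IsArc D) t × Unique t × Linked {D} t × Closes {D} t

arcList : {D : Digraph} (k : ℕ) → (Fin k → Pair D) → List (Pair D)
arcList k e = map e (allFin k)

{-# OPTIONS --safe #-}
-- Deleting the k prescribed arcs e₀, …, eₖ₋₁ from a 2k-arc-connected digraph leaves one in which
-- every nonempty proper vertex set X has in-degree ρ(X) ≥ k ≥ #{roots outside X}, for any k roots.
-- By Edmonds' branching theorem there are then arc-disjoint trails from the head of each eᵢ to the
-- tail of eᵢ₊₁ (indices mod k) that avoid every eⱼ, and e₀ P₀ e₁ P₁ ⋯ is the required tour.
-- Edmonds' theorem is proved as by Lovász: grow a branching from the first root, each time adding an
-- arc out of the reached set whose deletion keeps Edmonds' condition for the other roots.  Such an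
-- arc is found inside a tight set X (one where the condition holds with equality) not yet reached,
-- starting from the whole vertex set: some arc runs from the reached to the unreached part of X, and
-- if deleting it breaks the condition at Y, then Y is tight as well and, by submodularity of ρ, so is
-- the smaller set X ∩ Y.
module Submission where

open import Data.Bool using (Bool; true; false; _∧_; _∨_; not; if_then_else_)
import Data.Bool.Properties as Bool
open import Data.Bool.Properties using (∧-identityʳ; ∧-zeroʳ; ∧-conicalˡ; ∧-conicalʳ; not-involutive)
open import Data.Fin using (Fin; zero; suc; punchIn; inject₁; fromℕ; _≟_)
open import Data.Fin.Properties using (punchInᵢ≢i; any?)
open import Data.Fin.Subset using (∁)
open import Data.Fin.Subset.Properties using (anySubset?)
open import Data.List using (List; []; _∷_; _++_; [_]; concat; allFin)
import Data.List as List
open import Data.List.Membership.Propositional using (_∈_; _∉_)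
open import Data.List.Properties using (map-tabulate)
open import Data.List.Relation.Binary.Disjoint.Propositional using (Disjoint)
open import Data.List.Relation.Binary.Sublist.Propositional using (_⊆_; []; _∷_)
open import Data.List.Relation.Binary.Sublist.Propositional.Properties using (++⁺ˡ)
open import Data.List.Relation.Unary.All using (All; []; _∷_)
import Data.List.Relation.Unary.All as All
import Data.List.Relation.Unary.All.Properties as All
open import Data.List.Relation.Unary.AllPairs using ([]; _∷_)
import Data.List.Relation.Unary.AllPairs.Properties as AllPairs
open import Data.List.Relation.Unary.Any using (here; there)
open import Data.List.Relation.Unary.Unique.Propositional using (Unique)
import Data.List.Relation.Unary.Unique.Propositional.Properties as Unique
open import Data.Nat using (ℕ; zero; suc; _≤_; _<_; _+_; _*_; _∸_; ⌈_/2⌉; z≤n; s≤s; _<?_)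
open import Data.Nat.Induction using (<-wellFounded)
open import Data.Nat.ListAction using () renaming (sum to sumList)
open import Data.Nat.Properties hiding (_≟_)
open import Algebra.Properties.CommutativeMonoid.Sum +-0-commutativeMonoid
  using (sum; sum-syntax; ∑-distrib-+; sum-remove; sum-cong-≗; sum-replicate-zero)
open import Data.Product using (_×_; _,_; proj₁; proj₂; ∃-syntax; Σ-syntax)
open import Data.Sum using (_⊎_; inj₁; inj₂)
open import Data.Unit using (tt)
open import Data.Vec using (lookup; tabulate)
open import Data.Vec.Functional using (insertAt)
open import Data.Vec.Functional.Properties using (insertAt-lookup; insertAt-punchIn)
open import Data.Vec.Properties using (lookup∘tabulate; lookup-map; lookup⇒[]=)
open import Function using (_∘_; id; case_of_)
open import Function.Definitions using (Injective)
open import Induction.WellFounded using (Acc; acc)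
open import Relation.Binary.PropositionalEquality
  using (_≡_; _≢_; refl; sym; trans; cong; cong₂; subst; subst₂; module ≡-Reasoning)
open import Relation.Nullary using (¬_; Dec; yes; no; does; _×-dec_; contradiction)
open import Relation.Nullary.Decidable using (dec-true; dec-false)

open import Defs

⟦_⟧ : Bool → ℕ
⟦ true  ⟧ = 1
⟦ false ⟧ = 0

⟦⟧≤1 : ∀ b → ⟦ b ⟧ ≤ 1
⟦⟧≤1 true  = ≤-refl
⟦⟧≤1 false = z≤n

⟦⟧-mono : ∀ {p q} → (p ≡ true → q ≡ true) → ⟦ p ⟧ ≤ ⟦ q ⟧
⟦⟧-mono {false} _   = z≤n
⟦⟧-mono {true}  p⇒q rewrite p⇒q refl = ≤-refl

⟦⟧>0⇒true : ∀ {b} → 0 < ⟦ b ⟧ → b ≡ true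
⟦⟧>0⇒true {true} _ = refl

⟦∧⟧+⟦∨⟧ : ∀ p q → ⟦ p ∧ q ⟧ + ⟦ p ∨ q ⟧ ≡ ⟦ p ⟧ + ⟦ q ⟧
⟦∧⟧+⟦∨⟧ true  true  = refl
⟦∧⟧+⟦∨⟧ true  false = refl
⟦∧⟧+⟦∨⟧ false true  = refl
⟦∧⟧+⟦∨⟧ false false = refl

mask-≤-+ : ∀ p q r h → ⟦ p ⟧ ≤ ⟦ q ⟧ + ⟦ r ⟧ → ⟦ p ∧ h ⟧ ≤ ⟦ q ∧ h ⟧ + ⟦ r ∧ h ⟧
mask-≤-+ p q r true  le rewrite ∧-identityʳ p | ∧-identityʳ q | ∧-identityʳ r = le
mask-≤-+ p _ _ false _  rewrite ∧-zeroʳ p = z≤n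

mask-+-≤-+ : ∀ p p′ q r h → ⟦ p ⟧ + ⟦ p′ ⟧ ≤ ⟦ q ⟧ + ⟦ r ⟧ →
             ⟦ p ∧ h ⟧ + ⟦ p′ ∧ h ⟧ ≤ ⟦ q ∧ h ⟧ + ⟦ r ∧ h ⟧
mask-+-≤-+ p p′ q r true  le rewrite ∧-identityʳ p | ∧-identityʳ p′ | ∧-identityʳ q | ∧-identityʳ r = le
mask-+-≤-+ p p′ _ _ false _  rewrite ∧-zeroʳ p | ∧-zeroʳ p′ = z≤n

not≡true⇒false : ∀ {b} → not b ≡ true → b ≡ false
not≡true⇒false {false} _ = refl

if-⟦⟧ : ∀ b → (if b then 1 else 0) ≡ ⟦ b ⟧
if-⟦⟧ true  = refl
if-⟦⟧ false = refl

sum-mono-≤ : ∀ {n} {f g : Fin n → ℕ} → (∀ i → f i ≤ g i) → sum f ≤ sum g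
sum-mono-≤ {zero}  _   = z≤n
sum-mono-≤ {suc n} f≤g = +-mono-≤ (f≤g zero) (sum-mono-≤ (f≤g ∘ suc))

sum-mono-< : ∀ {n} {f g : Fin n → ℕ} → (∀ i → f i ≤ g i) → ∀ i → f i < g i → sum f < sum g
sum-mono-< {suc n} {f} {g} f≤g i fi<gi = begin-strict
  sum f                     ≡⟨ sum-remove f ⟩
  f i + sum (f ∘ punchIn i) <⟨ +-mono-<-≤ fi<gi (sum-mono-≤ (f≤g ∘ punchIn i)) ⟩
  g i + sum (g ∘ punchIn i) ≡⟨ sum-remove g ⟨
  sum g                     ∎
  where open ≤-Reasoning

sum-zero : ∀ {n} {f : Fin n → ℕ} → (∀ i → f i ≡ 0) → sum f ≡ 0
sum-zero {n} f≡0 = trans (sum-cong-≗ f≡0) (sum-replicate-zero n)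

sum-single : ∀ {n} {f : Fin n → ℕ} i → (∀ j → j ≢ i → f j ≡ 0) → sum f ≡ f i
sum-single {suc n} {f} i f≡0 = begin
  sum f                     ≡⟨ sum-remove f ⟩
  f i + sum (f ∘ punchIn i) ≡⟨ cong (f i +_) (sum-zero (λ j → f≡0 (punchIn i j) (punchInᵢ≢i i j))) ⟩
  f i + 0                   ≡⟨ +-identityʳ (f i) ⟩
  f i                       ∎
  where open ≡-Reasoning

sum>0⇒∃ : ∀ {n} (f : Fin n → ℕ) → 0 < sum f → ∃[ i ] 0 < f i
sum>0⇒∃ {suc n} f pos with f zero in eq
... | zero  = let i , fi>0 = sum>0⇒∃ (f ∘ suc) pos in suc i , fi>0
... | suc _ = zero , subst (0 <_) (sym eq) (s≤s z≤n)

sum≤n : ∀ {n} {f : Fin n → ℕ} → (∀ i → f i ≤ 1) → sum f ≤ n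
sum≤n {zero}  _   = z≤n
sum≤n {suc n} f≤1 = +-mono-≤ (f≤1 zero) (sum≤n (f≤1 ∘ suc))

sumList-tabulate : ∀ {n} (f : Fin n → ℕ) → sumList (List.tabulate f) ≡ sum f
sumList-tabulate {zero}  f = refl
sumList-tabulate {suc n} f = cong (f zero +_) (sumList-tabulate (f ∘ suc))

sumList-allFin : ∀ {n} (f : Fin n → ℕ) → sumList (List.map f (allFin n)) ≡ sum f
sumList-allFin f = trans (cong sumList (map-tabulate id f)) (sumList-tabulate f)

-- Vertex sets, arc sets and in-degrees

VertexSet : ℕ → Set
VertexSet n = Fin n → Bool

ArcSet : ℕ → Set
ArcSet n = Fin n → Fin n → Bool

Arc : ℕ → Set
Arc n = Fin n × Fin n

module _ {n : ℕ} where

  Inhabited : VertexSet n → Set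
  Inhabited X = ∃[ a ] X a ≡ true

  full : VertexSet n
  full _ = true

  ｛_｝ : Fin n → VertexSet n
  ｛ v ｝ a = does (a ≟ v)

  ｛｝-self : ∀ v → ｛ v ｝ v ≡ true
  ｛｝-self v = dec-true (v ≟ v) refl

  ｛｝-other : ∀ {a v} → a ≢ v → ｛ v ｝ a ≡ false
  ｛｝-other {a} {v} = dec-false (a ≟ v)

  ∈｛｝⇒≡ : ∀ {a v} → ｛ v ｝ a ≡ true → a ≡ v
  ∈｛｝⇒≡ {a} {v} a∈｛v｝ with a ≟ v
  ... | yes a≡v = a≡v
  ∈｛｝⇒≡ {a} {v} () | no _

  infixr 7 _∩_
  infixr 6 _∪_ _∖_

  _∩_ _∪_ _∖_ : VertexSet n → VertexSet n → VertexSet n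
  (X ∩ Y) a = X a ∧ Y a
  (X ∪ Y) a = X a ∨ Y a
  (X ∖ Y) a = X a ∧ not (Y a)

  ∪-introˡ : ∀ X Y {a} → X a ≡ true → (X ∪ Y) a ≡ true
  ∪-introˡ X Y {a} a∈X = cong (_∨ Y a) a∈X

  ∪-introʳ : ∀ X Y {a} → Y a ≡ true → (X ∪ Y) a ≡ true
  ∪-introʳ X Y {a} a∈Y = trans (cong (X a ∨_) a∈Y) (Bool.∨-zeroʳ (X a))

  card : VertexSet n → ℕ
  card X = ∑[ a < n ] ⟦ X a ⟧

  card-⊂ : ∀ {X Y a} → (∀ i → Y i ≡ true → X i ≡ true) → X a ≡ true → Y a ≡ false → card Y < card X
  card-⊂ {a = a} Y⊆X a∈X a∉Y =
    sum-mono-< (λ i → ⟦⟧-mono (Y⊆X i)) a (subst₂ (λ s t → ⟦ s ⟧ < ⟦ t ⟧) (sym a∉Y) (sym a∈X) (s≤s z≤n))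

  _∈ᴬ_ _∉ᴬ_ : Arc n → ArcSet n → Set
  p ∈ᴬ H = H (proj₁ p) (proj₂ p) ≡ true
  p ∉ᴬ H = ¬ p ∈ᴬ H

  _⊆ᴬ_ : ArcSet n → ArcSet n → Set
  M ⊆ᴬ H = ∀ {p} → p ∈ᴬ M → p ∈ᴬ H

  ｛_｝ᴬ : Arc n → ArcSet n
  ｛ u , v ｝ᴬ a b = ｛ u ｝ a ∧ ｛ v ｝ b

  ∈｛｝ᴬ : ∀ p → p ∈ᴬ ｛ p ｝ᴬ
  ∈｛｝ᴬ (u , v) = cong₂ _∧_ (｛｝-self u) (｛｝-self v)

  _∖ᴬ_ : ArcSet n → ArcSet n → ArcSet n
  (H ∖ᴬ E) a b = H a b ∧ not (E a b)

  ∖ᴬ⁺ : ∀ H M p → p ∈ᴬ H → p ∉ᴬ M → p ∈ᴬ (H ∖ᴬ M)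
  ∖ᴬ⁺ H M p p∈H p∉M = cong₂ _∧_ p∈H (cong not (Bool.¬-not p∉M))

  ∖ᴬ⁻ˡ : ∀ H M p → p ∈ᴬ (H ∖ᴬ M) → p ∈ᴬ H
  ∖ᴬ⁻ˡ H M p p∈H∖M = ∧-conicalˡ _ _ p∈H∖M

  ∖ᴬ⁻ʳ : ∀ H M p → p ∈ᴬ (H ∖ᴬ M) → p ∉ᴬ M
  ∖ᴬ⁻ʳ H M p p∈H∖M = Bool.not-¬ (not≡true⇒false (∧-conicalʳ _ _ p∈H∖M))

  ∖ᴬ-antitone : ∀ H {M M′} → M′ ⊆ᴬ M → (H ∖ᴬ M) ⊆ᴬ (H ∖ᴬ M′)
  ∖ᴬ-antitone H {M} {M′} M′⊆M {p} p∈H∖M = ∖ᴬ⁺ H M′ p (∖ᴬ⁻ˡ H M p p∈H∖M) (∖ᴬ⁻ʳ H M p p∈H∖M ∘ M′⊆M)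

  ∖ᴬ-∖ᴬ⁻ : ∀ H M E p → p ∈ᴬ (H ∖ᴬ (M ∖ᴬ E)) → p ∈ᴬ (H ∖ᴬ M) ⊎ p ∈ᴬ E
  ∖ᴬ-∖ᴬ⁻ H M E p@(a , b) p∈ with E a b Bool.≟ true
  ... | yes p∈E = inj₂ p∈E
  ... | no  p∉E = inj₁ (∖ᴬ⁺ H M p (∖ᴬ⁻ˡ H (M ∖ᴬ E) p p∈) λ p∈M → ∖ᴬ⁻ʳ H (M ∖ᴬ E) p p∈ (∖ᴬ⁺ M E p p∈M p∉E))

  ∑∑-mono-≤ : ∀ {f g : Fin n → Fin n → ℕ} → (∀ a b → f a b ≤ g a b) →
              ∑[ a < n ] ∑[ b < n ] f a b ≤ ∑[ a < n ] ∑[ b < n ] g a b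
  ∑∑-mono-≤ f≤g = sum-mono-≤ (λ a → sum-mono-≤ (f≤g a))

  ∑∑-distrib-+ : ∀ (f g : Fin n → Fin n → ℕ) →
                 ∑[ a < n ] ∑[ b < n ] (f a b + g a b) ≡ ∑[ a < n ] ∑[ b < n ] f a b + ∑[ a < n ] ∑[ b < n ] g a b
  ∑∑-distrib-+ f g = trans (sum-cong-≗ λ a → ∑-distrib-+ (f a) (g a)) (∑-distrib-+ (sum ∘ f) (sum ∘ g))

  countArcs : ArcSet n → (Fin n → Fin n → Bool) → ℕ
  countArcs H P = ∑[ a < n ] ∑[ b < n ] ⟦ P a b ∧ H a b ⟧

  countArcs-mono : ∀ {H M} P → (∀ {a b} → P a b ≡ true → H a b ≡ true → M a b ≡ true) →
                   countArcs H P ≤ countArcs M P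
  countArcs-mono P P∧H⇒M = ∑∑-mono-≤ λ a b → ⟦⟧-mono λ P∧H →
    let Pab = ∧-conicalˡ _ _ P∧H in cong₂ _∧_ Pab (P∧H⇒M Pab (∧-conicalʳ _ _ P∧H))

  countArcs-≤-+ : ∀ H {P Q R : Fin n → Fin n → Bool} → (∀ a b → ⟦ P a b ⟧ ≤ ⟦ Q a b ⟧ + ⟦ R a b ⟧) →
                  countArcs H P ≤ countArcs H Q + countArcs H R
  countArcs-≤-+ H {P} {Q} {R} P≤Q+R = begin
    countArcs H P
      ≤⟨ ∑∑-mono-≤ (λ a b → mask-≤-+ (P a b) (Q a b) (R a b) (H a b) (P≤Q+R a b)) ⟩
    ∑[ a < n ] ∑[ b < n ] (⟦ Q a b ∧ H a b ⟧ + ⟦ R a b ∧ H a b ⟧)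
      ≡⟨ ∑∑-distrib-+ _ _ ⟩
    countArcs H Q + countArcs H R
      ∎
    where open ≤-Reasoning

  countArcs-+-≤-+ : ∀ H {P P′ Q R : Fin n → Fin n → Bool} →
                    (∀ a b → ⟦ P a b ⟧ + ⟦ P′ a b ⟧ ≤ ⟦ Q a b ⟧ + ⟦ R a b ⟧) →
                    countArcs H P + countArcs H P′ ≤ countArcs H Q + countArcs H R
  countArcs-+-≤-+ H {P} {P′} {Q} {R} P+P′≤Q+R = begin
    countArcs H P + countArcs H P′
      ≡⟨ ∑∑-distrib-+ _ _ ⟨
    ∑[ a < n ] ∑[ b < n ] (⟦ P a b ∧ H a b ⟧ + ⟦ P′ a b ∧ H a b ⟧)
      ≤⟨ ∑∑-mono-≤ (λ a b → mask-+-≤-+ (P a b) (P′ a b) (Q a b) (R a b) (H a b) (P+P′≤Q+R a b)) ⟩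
    ∑[ a < n ] ∑[ b < n ] (⟦ Q a b ∧ H a b ⟧ + ⟦ R a b ∧ H a b ⟧)
      ≡⟨ ∑∑-distrib-+ _ _ ⟩
    countArcs H Q + countArcs H R
      ∎
    where open ≤-Reasoning

  countArcs-｛｝ᴬ : ∀ P u v → countArcs ｛ u , v ｝ᴬ P ≡ ⟦ P u v ⟧
  countArcs-｛｝ᴬ P u v = begin
    countArcs ｛ u , v ｝ᴬ P
      ≡⟨ sum-single u (λ a a≢u → sum-zero λ b → vanish (P a b) (cong (_∧ ｛ v ｝ b) (｛｝-other a≢u))) ⟩
    ∑[ b < n ] ⟦ P u b ∧ ｛ u ｝ u ∧ ｛ v ｝ b ⟧
      ≡⟨ sum-single v (λ b b≢v → vanish (P u b) (trans (cong (｛ u ｝ u ∧_) (｛｝-other b≢v)) (∧-zeroʳ _))) ⟩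
    ⟦ P u v ∧ ｛ u ｝ u ∧ ｛ v ｝ v ⟧
      ≡⟨ cong₂ (λ s t → ⟦ P u v ∧ s ∧ t ⟧) (｛｝-self u) (｛｝-self v) ⟩
    ⟦ P u v ∧ true ⟧
      ≡⟨ cong ⟦_⟧ (∧-identityʳ (P u v)) ⟩
    ⟦ P u v ⟧
      ∎
    where
    open ≡-Reasoning
    vanish : ∀ p {s} → s ≡ false → ⟦ p ∧ s ⟧ ≡ 0
    vanish p refl = cong ⟦_⟧ (∧-zeroʳ p)

  countArcs>0⇒∃ : ∀ H P → 0 < countArcs H P → ∃[ a ] ∃[ b ] (P a b ≡ true × H a b ≡ true)
  countArcs>0⇒∃ H P pos =
    let a , pos′ = sum>0⇒∃ _ pos
        b , pos″ = sum>0⇒∃ _ pos′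
        P∧H      = ⟦⟧>0⇒true pos″
    in a , b , ∧-conicalˡ _ _ P∧H , ∧-conicalʳ _ _ P∧H

  enters : VertexSet n → Fin n → Fin n → Bool
  enters X a b = not (X a) ∧ X b

  inDegree : ArcSet n → VertexSet n → ℕ
  inDegree H X = countArcs H (enters X)

  inDegree-cong : ∀ H {X Y} → (∀ a → X a ≡ Y a) → inDegree H X ≡ inDegree H Y
  inDegree-cong H X≗Y = sum-cong-≗ λ a → sum-cong-≗ λ b →
    cong₂ (λ s t → ⟦ (not s ∧ t) ∧ H a b ⟧) (X≗Y a) (X≗Y b)

  inDegree-full : ∀ H → inDegree H full ≡ 0
  inDegree-full H = sum-zero {n} λ a → sum-zero {n} λ b → refl

  inDegree-submodular : ∀ H X Y → inDegree H (X ∩ Y) + inDegree H (X ∪ Y) ≤ inDegree H X + inDegree H Y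
  inDegree-submodular H X Y = countArcs-+-≤-+ H λ a b → pointwise (X a) (Y a) (X b) (Y b)
    where
    pointwise : ∀ xa ya xb yb → ⟦ not (xa ∧ ya) ∧ xb ∧ yb ⟧ + ⟦ not (xa ∨ ya) ∧ (xb ∨ yb) ⟧ ≤
                                ⟦ not xa ∧ xb ⟧ + ⟦ not ya ∧ yb ⟧
    pointwise true  true  xb yb = z≤n
    pointwise true  false xb yb = ≤-trans (≤-reflexive (+-identityʳ _)) (⟦⟧-mono (∧-conicalʳ xb yb))
    pointwise false true  xb yb = +-monoˡ-≤ 0 (⟦⟧-mono (∧-conicalˡ xb yb))
    pointwise false false xb yb = ≤-reflexive (⟦∧⟧+⟦∨⟧ xb yb)

  inDegree-∖ : ∀ H X V → inDegree H (X ∖ V) ≤ inDegree H X + countArcs H (λ a b → (X ∩ V) a ∧ (X ∖ V) b)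
  inDegree-∖ H X V = countArcs-≤-+ H λ a b → pointwise (X a) (V a) (X b) (V b)
    where
    pointwise : ∀ xa va xb vb → ⟦ not (xa ∧ not va) ∧ xb ∧ not vb ⟧ ≤
                                ⟦ not xa ∧ xb ⟧ + ⟦ (xa ∧ va) ∧ xb ∧ not vb ⟧
    pointwise true  va xb vb rewrite not-involutive va = ≤-refl
    pointwise false va xb vb = ≤-trans (⟦⟧-mono (∧-conicalˡ xb (not vb))) (m≤m+n _ 0)

  inDegree-∖ᴬ : ∀ H E X → inDegree H X ≤ inDegree (H ∖ᴬ E) X + countArcs E (enters X)
  inDegree-∖ᴬ H E X = ≤-trans (∑∑-mono-≤ λ a b → pointwise (enters X a b) (H a b) (E a b))
                              (≤-reflexive (∑∑-distrib-+ _ _))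
    where
    pointwise : ∀ p h e → ⟦ p ∧ h ⟧ ≤ ⟦ p ∧ h ∧ not e ⟧ + ⟦ p ∧ e ⟧
    pointwise false _     _     = z≤n
    pointwise true  false _     = z≤n
    pointwise true  true  true  = ≤-refl
    pointwise true  true  false = ≤-refl

  inDegree-deleteArc : ∀ H X u v → inDegree H X ≤ inDegree (H ∖ᴬ ｛ u , v ｝ᴬ) X + ⟦ enters X u v ⟧
  inDegree-deleteArc H X u v = ≤-trans (inDegree-∖ᴬ H ｛ u , v ｝ᴬ X)
    (≤-reflexive (cong (inDegree (H ∖ᴬ ｛ u , v ｝ᴬ) X +_) (countArcs-｛｝ᴬ (enters X) u v)))

  deleteAll : ∀ {k} → (Fin k → Arc n) → ArcSet n → ArcSet n
  deleteAll {zero}  e H = H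
  deleteAll {suc k} e H = deleteAll (e ∘ suc) H ∖ᴬ ｛ e zero ｝ᴬ

  deleteAll-⊆ : ∀ {k} (e : Fin k → Arc n) H → deleteAll e H ⊆ᴬ H
  deleteAll-⊆ {zero}  e H p∈      = p∈
  deleteAll-⊆ {suc k} e H {p} p∈ = deleteAll-⊆ (e ∘ suc) H (∖ᴬ⁻ˡ (deleteAll (e ∘ suc) H) ｛ e zero ｝ᴬ p p∈)

  deleteAll-deletes : ∀ {k} (e : Fin k → Arc n) H i → e i ∉ᴬ deleteAll e H
  deleteAll-deletes {suc k} e H zero    e₀∈ =
    ∖ᴬ⁻ʳ (deleteAll (e ∘ suc) H) ｛ e zero ｝ᴬ (e zero) e₀∈ (∈｛｝ᴬ (e zero))
  deleteAll-deletes {suc k} e H (suc i) eᵢ∈ =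
    deleteAll-deletes (e ∘ suc) H i (∖ᴬ⁻ˡ (deleteAll (e ∘ suc) H) ｛ e zero ｝ᴬ (e (suc i)) eᵢ∈)

  inDegree-deleteAll : ∀ {k} (e : Fin k → Arc n) H X → inDegree H X ≤ inDegree (deleteAll e H) X + k
  inDegree-deleteAll {zero}  e H X = ≤-reflexive (sym (+-identityʳ _))
  inDegree-deleteAll {suc k} e H X = begin
    inDegree H X                                        ≤⟨ inDegree-deleteAll (e ∘ suc) H X ⟩
    inDegree G X + k                                    ≤⟨ +-monoˡ-≤ k (inDegree-deleteArc G X u v) ⟩
    inDegree (G ∖ᴬ ｛ u , v ｝ᴬ) X + ⟦ enters X u v ⟧ + k ≤⟨ +-monoˡ-≤ k (+-monoʳ-≤ _ (⟦⟧≤1 _)) ⟩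
    inDegree (G ∖ᴬ ｛ u , v ｝ᴬ) X + 1 + k               ≡⟨ +-assoc _ 1 k ⟩
    inDegree (G ∖ᴬ ｛ u , v ｝ᴬ) X + suc k               ∎
    where
    open ≤-Reasoning
    G = deleteAll (e ∘ suc) H
    u = proj₁ (e zero)
    v = proj₂ (e zero)

  -- Edmonds' condition

  module _ {m : ℕ} where

    rootsOutside : (Fin m → Fin n) → VertexSet n → ℕ
    rootsOutside r X = ∑[ j < m ] ⟦ not (X (r j)) ⟧

    rootsOutside-cong : ∀ r {X Y} → (∀ a → X a ≡ Y a) → rootsOutside r X ≡ rootsOutside r Y
    rootsOutside-cong r X≗Y = sum-cong-≗ λ j → cong (⟦_⟧ ∘ not) (X≗Y (r j))

    rootsOutside≤m : ∀ r X → rootsOutside r X ≤ m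
    rootsOutside≤m r X = sum≤n λ j → ⟦⟧≤1 _

    rootsOutside-antitone : ∀ r {X Y} → (∀ a → X a ≡ true → Y a ≡ true) → rootsOutside r Y ≤ rootsOutside r X
    rootsOutside-antitone r X⊆Y = sum-mono-≤ λ j → ⟦⟧-mono (not-antitone (X⊆Y (r j)))
      where
      not-antitone : ∀ {p q} → (p ≡ true → q ≡ true) → not q ≡ true → not p ≡ true
      not-antitone {false} _   _  = refl
      not-antitone {true}  p⇒q ¬q rewrite p⇒q refl = ¬q

    rootsOutside-modular : ∀ r X Y →
                           rootsOutside r (X ∩ Y) + rootsOutside r (X ∪ Y) ≡ rootsOutside r X + rootsOutside r Y
    rootsOutside-modular r X Y = begin
      rootsOutside r (X ∩ Y) + rootsOutside r (X ∪ Y)     ≡⟨ ∑-distrib-+ (outside (X ∩ Y)) (outside (X ∪ Y)) ⟨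
      ∑[ j < m ] (outside (X ∩ Y) j + outside (X ∪ Y) j) ≡⟨ sum-cong-≗ (λ j → pointwise (X (r j)) (Y (r j))) ⟩
      ∑[ j < m ] (outside X j + outside Y j)             ≡⟨ ∑-distrib-+ (outside X) (outside Y) ⟩
      rootsOutside r X + rootsOutside r Y                 ∎
      where
      open ≡-Reasoning
      outside : VertexSet n → Fin m → ℕ
      outside Z j = ⟦ not (Z (r j)) ⟧
      pointwise : ∀ p q → ⟦ not (p ∧ q) ⟧ + ⟦ not (p ∨ q) ⟧ ≡ ⟦ not p ⟧ + ⟦ not q ⟧
      pointwise true  true  = refl
      pointwise true  false = refl
      pointwise false true  = refl
      pointwise false false = refl

    EdmondsCondition : ArcSet n → (Fin m → Fin n) → Set
    EdmondsCondition H r = ∀ X → Inhabited X → rootsOutside r X ≤ inDegree H X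

    Tight : ArcSet n → (Fin m → Fin n) → VertexSet n → Set
    Tight H r X = inDegree H X ≤ rootsOutside r X

    Deficient : ArcSet n → (Fin m → Fin n) → VertexSet n → Set
    Deficient H r X = Inhabited X × inDegree H X < rootsOutside r X

    tight-∩ : ∀ {H r X Y} → EdmondsCondition H r → Tight H r X → Tight H r Y → Inhabited (X ∪ Y) →
              Tight H r (X ∩ Y)
    tight-∩ {H} {r} {X} {Y} edmonds X-tight Y-tight X∪Y-inhabited =
      +-cancelʳ-≤ (inDegree H (X ∪ Y)) _ _ (begin
        inDegree H (X ∩ Y) + inDegree H (X ∪ Y)          ≤⟨ inDegree-submodular H X Y ⟩
        inDegree H X + inDegree H Y                      ≤⟨ +-mono-≤ X-tight Y-tight ⟩
        rootsOutside r X + rootsOutside r Y              ≡⟨ rootsOutside-modular r X Y ⟨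
        rootsOutside r (X ∩ Y) + rootsOutside r (X ∪ Y)  ≤⟨ +-monoʳ-≤ _ (edmonds (X ∪ Y) X∪Y-inhabited) ⟩
        rootsOutside r (X ∩ Y) + inDegree H (X ∪ Y)      ∎)
      where open ≤-Reasoning

    deficient-after-deletion : ∀ {M r Y u v} → EdmondsCondition M r → Deficient (M ∖ᴬ ｛ u , v ｝ᴬ) r Y →
                               enters Y u v ≡ true × Tight M r Y
    deficient-after-deletion {M} {r} {Y} {u} {v} edmonds (Y-inhabited , deficient) =
      ⟦⟧>0⇒true uv-enters-Y , Y-tight
      where
      open ≤-Reasoning
      M′ = M ∖ᴬ ｛ u , v ｝ᴬ
      uv-enters-Y : 1 ≤ ⟦ enters Y u v ⟧
      uv-enters-Y = +-cancelˡ-≤ (inDegree M′ Y) 1 _ (begin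
        inDegree M′ Y + 1                   ≡⟨ +-comm (inDegree M′ Y) 1 ⟩
        1 + inDegree M′ Y                   ≤⟨ deficient ⟩
        rootsOutside r Y                    ≤⟨ edmonds Y Y-inhabited ⟩
        inDegree M Y                        ≤⟨ inDegree-deleteArc M Y u v ⟩
        inDegree M′ Y + ⟦ enters Y u v ⟧    ∎)
      Y-tight : Tight M r Y
      Y-tight = begin
        inDegree M Y                        ≤⟨ inDegree-deleteArc M Y u v ⟩
        inDegree M′ Y + ⟦ enters Y u v ⟧    ≤⟨ +-monoʳ-≤ _ (⟦⟧≤1 _) ⟩
        inDegree M′ Y + 1                   ≡⟨ +-comm (inDegree M′ Y) 1 ⟩
        1 + inDegree M′ Y                   ≤⟨ deficient ⟩
        rootsOutside r Y                    ∎

    deficient? : ∀ H r X → Dec (Deficient H r X)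
    deficient? H r X = any? (λ a → X a Bool.≟ true) ×-dec (inDegree H X <? rootsOutside r X)

    edmonds-or-deficient : ∀ H r → EdmondsCondition H r ⊎ ∃[ Y ] Deficient H r Y
    edmonds-or-deficient H r with anySubset? (deficient? H r ∘ lookup)
    ... | yes (S , S-deficient) = inj₂ (lookup S , S-deficient)
    ... | no  none-deficient    = inj₁ λ X X-inhabited → ≮⇒≥ λ X-deficient →
      none-deficient (tabulate X , deficient-cong (sym ∘ lookup∘tabulate X) (X-inhabited , X-deficient))
      where
      deficient-cong : ∀ {X Y} → (∀ a → X a ≡ Y a) → Deficient H r X → Deficient H r Y
      deficient-cong X≗Y ((a , a∈X) , deficient) =
        (a , trans (sym (X≗Y a)) a∈X) , subst₂ _<_ (inDegree-cong H X≗Y) (rootsOutside-cong r X≗Y) deficient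

  -- Trails and linkages

  data IsWalk : Fin n → Fin n → List (Arc n) → Set where
    []   : ∀ {a} → IsWalk a a []
    step : ∀ {a b c ps} → IsWalk b c ps → IsWalk a c ((a , b) ∷ ps)

  ++-walk : ∀ {a b c ps qs} → IsWalk a b ps → IsWalk b c qs → IsWalk a c (ps ++ qs)
  ++-walk []        qs = qs
  ++-walk (step ps) qs = step (++-walk ps qs)

  concat-walk : ∀ {m} (z : Fin (suc m) → Fin n) (s : Fin m → List (Arc n)) →
                (∀ i → IsWalk (z (inject₁ i)) (z (suc i)) (s i)) →
                IsWalk (z zero) (z (fromℕ m)) (concat (List.tabulate s))
  concat-walk {zero}  z s walks = []
  concat-walk {suc m} z s walks = ++-walk (walks zero) (concat-walk (z ∘ suc) (s ∘ suc) (walks ∘ suc))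

  record Trail (H : ArcSet n) (s t : Fin n) : Set where
    constructor trail
    field
      arcs   : List (Arc n)
      walk   : IsWalk s t arcs
      inside : All (_∈ᴬ H) arcs
      unique : Unique arcs

  open Trail public

  Trail-[] : ∀ {H s} → Trail H s s
  Trail-[] = trail [] [] [] []

  Trail-mono : ∀ {H G s t} → H ⊆ᴬ G → Trail H s t → Trail G s t
  Trail-mono H⊆G (trail ps w ps⊆H u) = trail ps w (All.map H⊆G ps⊆H) u

  Trail-snoc : ∀ {H s u v} (T : Trail H s u) → (u , v) ∈ᴬ H → (u , v) ∉ arcs T → Trail H s v
  Trail-snoc (trail ps w ps⊆H u) uv∈H uv∉ps =
    trail (ps ++ [ _ ]) (++-walk w (step [])) (All.++⁺ ps⊆H (uv∈H ∷ []))
          (Unique.++⁺ u ([] ∷ []) λ { (uv∈ps , here refl) → uv∉ps uv∈ps })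

  record Linkage {m} (H : ArcSet n) (x y : Fin m → Fin n) : Set where
    field
      path     : ∀ i → Trail H (x i) (y i)
      disjoint : ∀ {i j} → i ≢ j → Disjoint (arcs (path i)) (arcs (path j))

  -- Edmonds' branching theorem, after Lovász

  module Branching {m} (H : ArcSet n) (x : Fin (suc m) → Fin n) (edmonds : EdmondsCondition H x) where

    root : Fin n
    root = x zero

    others : Fin m → Fin n
    others = x ∘ suc

    record Arborescence : Set where
      field
        rest         : ArcSet n
        reached      : VertexSet n
        rest⊆H       : rest ⊆ᴬ H
        root-reached : reached root ≡ true
        used⇒reached : ∀ {a b} → (a , b) ∈ᴬ (H ∖ᴬ rest) → reached b ≡ true
        path         : ∀ {v} → reached v ≡ true → Trail (H ∖ᴬ rest) root v
        condition    : EdmondsCondition rest others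

    record SafeArc (A : Arborescence) : Set where
      open Arborescence A
      field
        u v         : Fin n
        u-reached   : reached u ≡ true
        v-unreached : reached v ≡ false
        uv∈rest     : (u , v) ∈ᴬ rest
        condition′  : EdmondsCondition (rest ∖ᴬ ｛ u , v ｝ᴬ) others

    initial : Arborescence
    initial = record
      { rest         = H
      ; reached      = ｛ root ｝
      ; rest⊆H       = id
      ; root-reached = ｛｝-self root
      ; used⇒reached = λ {a} {b} ab∈H∖H → contradiction (∖ᴬ⁻ˡ H H (a , b) ab∈H∖H) (∖ᴬ⁻ʳ H H (a , b) ab∈H∖H)
      ; path         = λ v∈｛root｝ → subst (Trail (H ∖ᴬ H) root) (sym (∈｛｝⇒≡ v∈｛root｝)) Trail-[]
      ; condition    = λ X X-inhabited → ≤-trans (m≤n+m _ _) (edmonds X X-inhabited)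
      }

    module _ (A : Arborescence) where
      open Arborescence A

      leavesReachedIn : VertexSet n → Fin n → Fin n → Bool
      leavesReachedIn X a b = (X ∩ reached) a ∧ (X ∖ reached) b

      -- Edmonds' condition for all roots at X ∖ reached, which misses the root, exceeds by one the
      -- tightness of X for the other roots.
      tight⇒leavesReachedIn : ∀ {X} → Tight rest others X → Inhabited (X ∖ reached) →
                              1 ≤ countArcs rest (leavesReachedIn X)
      tight⇒leavesReachedIn {X} X-tight W-inhabited = +-cancelˡ-≤ (rootsOutside others X) 1 _ (begin
        rootsOutside others X + 1       ≡⟨ +-comm (rootsOutside others X) 1 ⟩
        1 + rootsOutside others X       ≤⟨ +-monoʳ-≤ 1 (rootsOutside-antitone others {W} {X} W⊆X) ⟩
        1 + rootsOutside others W       ≡⟨ cong (λ s → ⟦ not s ⟧ + rootsOutside others W) W-root ⟨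
        rootsOutside x W                ≤⟨ edmonds W W-inhabited ⟩
        inDegree H W                    ≤⟨ countArcs-mono (enters W) entering-W-in-rest ⟩
        inDegree rest W                 ≤⟨ inDegree-∖ rest X reached ⟩
        inDegree rest X + leaving       ≤⟨ +-monoˡ-≤ leaving X-tight ⟩
        rootsOutside others X + leaving ∎)
        where
        open ≤-Reasoning
        W = X ∖ reached
        leaving = countArcs rest (leavesReachedIn X)
        W⊆X : ∀ a → W a ≡ true → X a ≡ true
        W⊆X a = ∧-conicalˡ (X a) (not (reached a))
        W-root : W root ≡ false
        W-root = trans (cong (λ s → X root ∧ not s) root-reached) (∧-zeroʳ (X root))
        entering-W-in-rest : ∀ {a b} → enters W a b ≡ true → H a b ≡ true → rest a b ≡ true
        entering-W-in-rest {a} {b} a→W ab∈H = Bool.¬-not λ ab∉rest →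
          b∉reached (used⇒reached (∖ᴬ⁺ H rest (a , b) ab∈H (Bool.not-¬ ab∉rest)))
          where
          b∉reached : reached b ≢ true
          b∉reached = Bool.not-¬ (not≡true⇒false (∧-conicalʳ (X b) _ (∧-conicalʳ (not (W a)) (W b) a→W)))

      -- A deficient set Y after deleting ab is entered by ab, so X ∩ Y loses a but keeps the
      -- unreached vertex b.
      safe-arc-within : ∀ X → Acc _<_ (card X) → Tight rest others X → Inhabited (X ∖ reached) → SafeArc A
      safe-arc-within X (acc smaller) X-tight X⊈reached =
        let a , b , ab-leaves , ab∈rest =
              countArcs>0⇒∃ rest (leavesReachedIn X) (tight⇒leavesReachedIn X-tight X⊈reached)
            a∈X∩R = ∧-conicalˡ ((X ∩ reached) a) ((X ∖ reached) b) ab-leaves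
            b∈X∖R = ∧-conicalʳ ((X ∩ reached) a) ((X ∖ reached) b) ab-leaves
            a∈X   = ∧-conicalˡ (X a) (reached a) a∈X∩R
            b∈X   = ∧-conicalˡ (X b) (not (reached b)) b∈X∖R
            b∉R   = ∧-conicalʳ (X b) (not (reached b)) b∈X∖R
        in case edmonds-or-deficient (rest ∖ᴬ ｛ a , b ｝ᴬ) others of λ where
          (inj₁ still-edmonds) → record
            { u = a ; v = b ; u-reached = ∧-conicalʳ (X a) (reached a) a∈X∩R ; v-unreached = not≡true⇒false b∉R
            ; uv∈rest = ab∈rest ; condition′ = still-edmonds }
          (inj₂ (Y , Y-deficient)) →
            let ab-enters-Y , Y-tight =
                  deficient-after-deletion {M = rest} {r = others} {Y = Y} {u = a} {v = b} condition Y-deficient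
                a∉Y = not≡true⇒false (∧-conicalˡ (not (Y a)) (Y b) ab-enters-Y)
                b∈Y = ∧-conicalʳ (not (Y a)) (Y b) ab-enters-Y
            in safe-arc-within (X ∩ Y)
                 (smaller (card-⊂ {X} {X ∩ Y} (λ i → ∧-conicalˡ (X i) (Y i)) a∈X
                                  (trans (cong (X a ∧_) a∉Y) (∧-zeroʳ (X a)))))
                 (tight-∩ {H = rest} {r = others} {X = X} {Y = Y} condition X-tight Y-tight (b , ∪-introˡ X Y b∈X))
                 (b , cong₂ _∧_ (cong₂ _∧_ b∈X b∈Y) b∉R)

      safe-arc : ∀ t → reached t ≡ false → SafeArc A
      safe-arc t t-unreached = safe-arc-within full (<-wellFounded _)
        (≤-trans (≤-reflexive (inDegree-full rest)) z≤n) (t , cong not t-unreached)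

    extend : (A : Arborescence) → SafeArc A → Arborescence
    extend A s = record
      { rest         = rest′
      ; reached      = reached ∪ ｛ v ｝
      ; rest⊆H       = rest⊆H ∘ rest′⊆rest
      ; root-reached = ∪-introˡ reached ｛ v ｝ root-reached
      ; used⇒reached = used⇒reached′
      ; path         = path′
      ; condition    = condition′
      }
      where
      open Arborescence A
      open SafeArc s
      rest′ = rest ∖ᴬ ｛ u , v ｝ᴬ
      rest′⊆rest : rest′ ⊆ᴬ rest
      rest′⊆rest {p} = ∖ᴬ⁻ˡ rest ｛ u , v ｝ᴬ p
      used⇒reached′ : ∀ {a b} → (a , b) ∈ᴬ (H ∖ᴬ rest′) → (reached ∪ ｛ v ｝) b ≡ true
      used⇒reached′ {a} {b} ab-used with ∖ᴬ-∖ᴬ⁻ H rest ｛ u , v ｝ᴬ (a , b) ab-used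
      ... | inj₁ ab-used-before = ∪-introˡ reached ｛ v ｝ (used⇒reached ab-used-before)
      ... | inj₂ ab≡uv          = ∪-introʳ reached ｛ v ｝ (∧-conicalʳ (｛ u ｝ a) (｛ v ｝ b) ab≡uv)
      old-paths : ∀ {c} → reached c ≡ true → Trail (H ∖ᴬ rest′) root c
      old-paths = Trail-mono (∖ᴬ-antitone H {rest} {rest′} rest′⊆rest) ∘ path
      path-to-v : Trail (H ∖ᴬ rest′) root v
      path-to-v = Trail-snoc (old-paths u-reached)
        (∖ᴬ⁺ H rest′ (u , v) (rest⊆H uv∈rest) λ uv∈rest′ → ∖ᴬ⁻ʳ rest ｛ u , v ｝ᴬ (u , v) uv∈rest′ (∈｛｝ᴬ (u , v)))
        (λ uv∈path → ∖ᴬ⁻ʳ H rest (u , v) (All.lookup (inside (path u-reached)) uv∈path) uv∈rest)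
      path′ : ∀ {c} → (reached ∪ ｛ v ｝) c ≡ true → Trail (H ∖ᴬ rest′) root c
      path′ {c} c-reached with reached c in c-reached-before
      ... | true  = old-paths c-reached-before
      ... | false = subst (Trail (H ∖ᴬ rest′) root) (sym (∈｛｝⇒≡ c-reached)) path-to-v

    unreached : Arborescence → ℕ
    unreached A = card (not ∘ Arborescence.reached A)

    extend-shrinks-unreached : ∀ A s → unreached (extend A s) < unreached A
    extend-shrinks-unreached A s =
      card-⊂ {not ∘ reached} {not ∘ (reached ∪ ｛ v ｝)} shrinks (cong not v-unreached)
             (cong not (∪-introʳ reached ｛ v ｝ (｛｝-self v)))
      where
      open Arborescence A
      open SafeArc s
      shrinks : ∀ c → not ((reached ∪ ｛ v ｝) c) ≡ true → not (reached c) ≡ true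
      shrinks c with reached c
      ... | true  = λ ()
      ... | false = λ _ → refl

    reach : ∀ t A → Acc _<_ (unreached A) → Σ[ B ∈ Arborescence ] Arborescence.reached B t ≡ true
    reach t A (acc smaller) with Arborescence.reached A t in t-reached
    ... | true  = A , t-reached
    ... | false = let s = safe-arc A t t-reached in
                  reach t (extend A s) (smaller (extend-shrinks-unreached A s))

    reaching : ∀ t → Σ[ A ∈ Arborescence ] Arborescence.reached A t ≡ true
    reaching t = reach t initial (<-wellFounded _)

  edmonds-linkage : ∀ {m} H (x y : Fin m → Fin n) → EdmondsCondition H x → Linkage H x y
  edmonds-linkage {zero}  H x y _       = record { path = λ () ; disjoint = λ { {()} } }
  edmonds-linkage {suc m} H x y edmonds = record { path = path′ ; disjoint = disjoint′ }
    where
    open Branching H x edmonds using (Arborescence; reaching)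
    open Arborescence (proj₁ (reaching (y zero)))
    first : Trail (H ∖ᴬ rest) (x zero) (y zero)
    first = path (proj₂ (reaching (y zero)))
    module L = Linkage (edmonds-linkage rest (x ∘ suc) (y ∘ suc) condition)
    path′ : ∀ i → Trail H (x i) (y i)
    path′ zero    = Trail-mono (λ {p} → ∖ᴬ⁻ˡ H rest p) first
    path′ (suc i) = Trail-mono rest⊆H (L.path i)
    first-apart : ∀ {p} j → p ∈ arcs first → p ∉ arcs (L.path j)
    first-apart j p∈first p∈other =
      ∖ᴬ⁻ʳ H rest _ (All.lookup (inside first) p∈first) (All.lookup (inside (L.path j)) p∈other)
    disjoint′ : ∀ {i j} → i ≢ j → Disjoint (arcs (path′ i)) (arcs (path′ j))
    disjoint′ {zero}  {zero}  0≢0 = contradiction refl 0≢0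
    disjoint′ {zero}  {suc j} _   (p∈first , p∈other) = first-apart j p∈first p∈other
    disjoint′ {suc i} {zero}  _   (p∈other , p∈first) = first-apart i p∈first p∈other
    disjoint′ {suc i} {suc j} i≢j = L.disjoint (i≢j ∘ cong suc)

-- Tours in a digraph

punchIn-fromℕ : ∀ {n} (i : Fin n) → punchIn (fromℕ n) i ≡ inject₁ i
punchIn-fromℕ zero    = refl
punchIn-fromℕ (suc i) = cong suc (punchIn-fromℕ i)

tabulate⊆concat : ∀ {A : Set} {m} (f : Fin m → A) (g : Fin m → List A) →
                  List.tabulate f ⊆ concat (List.tabulate (λ i → f i ∷ g i))
tabulate⊆concat {m = zero}  f g = []
tabulate⊆concat {m = suc m} f g = refl ∷ ++⁺ˡ (g zero) (tabulate⊆concat (f ∘ suc) (g ∘ suc))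

module _ (D : Digraph) where

  cutSize-∁ : ∀ X → cutSize D (tabulate (not ∘ X)) ≡ inDegree (adj D) X
  cutSize-∁ X = trans (sumList-allFin λ u → sumList (List.map (crossing u) (allFin (n D))))
                      (sum-cong-≗ λ u → trans (sumList-allFin (crossing u)) (sum-cong-≗ (pointwise u)))
    where
    S = tabulate (not ∘ X)
    crossing : Vertex D → Vertex D → ℕ
    crossing u v = if lookup S u ∧ not (lookup S v) ∧ adj D u v then 1 else 0
    pointwise : ∀ u v → crossing u v ≡ ⟦ enters X u v ∧ adj D u v ⟧
    pointwise u v rewrite lookup∘tabulate (not ∘ X) u | lookup∘tabulate (not ∘ X) v | not-involutive (X v)
                        | Bool.∧-assoc (not (X u)) (X v) (adj D u v) = if-⟦⟧ _

  edgeConnected⇒inDegree : ∀ {c} → EdgeConnected D c → ∀ X → Inhabited X → Inhabited (not ∘ X) →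
                           c ≤ inDegree (adj D) X
  edgeConnected⇒inDegree connected X (a , a∈X) (b , b∉X) =
    subst (_ ≤_) (cutSize-∁ X) (connected S (b , lookup⇒[]= b S (trans (lookup∘tabulate _ b) b∉X))
                                            (a , lookup⇒[]= a (∁ S) a∈∁S))
    where
    S = tabulate (not ∘ X)
    a∈∁S : lookup (∁ S) a ≡ true
    a∈∁S = trans (lookup-map a not S) (trans (cong not (lookup∘tabulate (not ∘ X) a))
                                              (trans (not-involutive (X a)) a∈X))

  edmonds-after-deletion : ∀ {k c} (e : Fin k → Pair D) → k + k ≤ c → EdgeConnected D c →
                           ∀ r → EdmondsCondition (deleteAll e (adj D)) r
  edmonds-after-deletion {k} e 2k≤c connected r X X-inhabited with any? (λ a → X a Bool.≟ false)
  ... | yes (b , b∉X) = ≤-trans (rootsOutside≤m r X) (+-cancelʳ-≤ k k _ (begin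
    k + k                                 ≤⟨ 2k≤c ⟩
    _                                     ≤⟨ edgeConnected⇒inDegree connected X X-inhabited (b , cong not b∉X) ⟩
    inDegree (adj D) X                    ≤⟨ inDegree-deleteAll e (adj D) X ⟩
    inDegree (deleteAll e (adj D)) X + k  ∎))
    where open ≤-Reasoning
  ... | no X-full = ≤-trans (≤-reflexive (sum-zero λ j → cong (⟦_⟧ ∘ not) (X-contains (r j)))) z≤n
    where
    X-contains : ∀ a → X a ≡ true
    X-contains a = Bool.¬-not λ a∉X → X-full (a , a∉X)

  walk⇒linked : ∀ {a c p ps} → IsWalk a c (p ∷ ps) →
                proj₁ p ≡ a × proj₂ (lastArc {D} p ps) ≡ c × Linked {D} (p ∷ ps)
  walk⇒linked (step [])       = refl , refl , tt
  walk⇒linked (step (step w)) = let _ , last≡c , linked = walk⇒linked (step w) in refl , last≡c , refl , linked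

  closed-walk⇒linked : ∀ {a t} → IsWalk a a t → Linked {D} t × Closes {D} t
  closed-walk⇒linked []       = tt , tt
  closed-walk⇒linked (step w) =
    let first≡a , last≡a , linked = walk⇒linked (step w) in linked , trans last≡a (sym first≡a)

  module _ {k} (e : Fin (suc k) → Pair D) where

    -- The tails of e₀, …, eₖ followed by the tail of e₀ again: cyclicTails (suc i) is the tail of the
    -- arc after eᵢ in cyclic order.
    cyclicTails : Fin (suc (suc k)) → Vertex D
    cyclicTails = insertAt (proj₁ ∘ e) (fromℕ (suc k)) (proj₁ (e zero))

    module _ (e-injective : Injective _≡_ _≡_ e)
             (L : Linkage (deleteAll e (adj D)) (proj₂ ∘ e) (cyclicTails ∘ suc)) where
      open Linkage L

      segment : Fin (suc k) → List (Pair D)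
      segment i = e i ∷ arcs (path i)

      tour : List (Pair D)
      tour = concat (List.tabulate segment)

      avoids : ∀ i j → e i ∉ arcs (path j)
      avoids i j eᵢ∈ = deleteAll-deletes e (adj D) i (All.lookup (inside (path j)) eᵢ∈)

      segment-unique : ∀ i → Unique (segment i)
      segment-unique i = All.tabulate (λ {p} p∈ eᵢ≡p → avoids i i (subst (_∈ arcs (path i)) (sym eᵢ≡p) p∈))
                       ∷ unique (path i)

      segments-disjoint : ∀ {i j} → i ≢ j → Disjoint (segment i) (segment j)
      segments-disjoint i≢j (here p≡eᵢ , here p≡eⱼ) = i≢j (e-injective (trans (sym p≡eᵢ) p≡eⱼ))
      segments-disjoint {i} {j} _ (here refl , there p∈) = avoids i j p∈
      segments-disjoint {i} {j} _ (there p∈ , here refl) = avoids j i p∈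
      segments-disjoint i≢j (there p∈ , there p∈′) = disjoint i≢j (p∈ , p∈′)

      tour-closed : IsWalk (proj₁ (e zero)) (proj₁ (e zero)) tour
      tour-closed = subst (λ z → IsWalk (proj₁ (e zero)) z tour) (insertAt-lookup (proj₁ ∘ e) (fromℕ (suc k)) _)
        (concat-walk cyclicTails segment λ i →
          subst (λ z → IsWalk z (cyclicTails (suc i)) (segment i)) (sym (tail-at i)) (step (walk (path i))))
        where
        tail-at : ∀ i → cyclicTails (inject₁ i) ≡ proj₁ (e i)
        tail-at i = trans (cong cyclicTails (sym (punchIn-fromℕ i)))
                          (insertAt-punchIn (proj₁ ∘ e) (fromℕ (suc k)) _ i)

      linkage⇒tour : (∀ i → IsArc D (e i)) → ∃[ t ] (IsTour D t × arcList {D} (suc k) e ⊆ t)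
      linkage⇒tour e-arcs = tour ,
        ( ( (λ ())
          , All.concat⁺ (All.tabulate⁺ λ i → e-arcs i ∷ All.map (deleteAll-⊆ e (adj D)) (inside (path i)))
          , Unique.concat⁺ (All.tabulate⁺ segment-unique) (AllPairs.tabulate⁺ segments-disjoint)
          , closed-walk⇒linked tour-closed )
        , subst (_⊆ tour) (sym (map-tabulate id e)) (tabulate⊆concat e (arcs ∘ path)) )

k+k≤bound : ∀ k d → 1 ≤ k → 1 ≤ d → k + k ≤ (2 * k ∸ 1) * ⌈ d /2⌉ + 1
k+k≤bound k@(suc _) (suc d) _ _ = begin
  k + k                           ≡⟨ cong (k +_) (+-identityʳ k) ⟨
  2 * k                           ≡⟨ m∸n+n≡m (s≤s z≤n) ⟨
  (2 * k ∸ 1) + 1                 ≤⟨ +-monoˡ-≤ 1 (m≤m*n (2 * k ∸ 1) ⌈ suc d /2⌉) ⟩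
  (2 * k ∸ 1) * ⌈ suc d /2⌉ + 1   ∎
  where open ≤-Reasoning

theorem7p1 : (k d c : ℕ) → 1 ≤ k → 1 ≤ d →
    (2 * k ∸ 1) * ⌈ d /2⌉ + 1 ≤ c →
    (D : Digraph) → EdgeConnected D c → HasDiameter D d →
    (e : Fin k → Pair D) → (∀ i → IsArc D (e i)) → Injective _≡_ _≡_ e →
    ∃[ t ] (IsTour D t × arcList {D} k e ⊆ t)
theorem7p1 (suc k) d c 1≤k 1≤d c-large D connected _ e e-arcs e-injective =
  linkage⇒tour D e e-injective linkage e-arcs
  where
  2k≤c : suc k + suc k ≤ c
  2k≤c = ≤-trans (k+k≤bound (suc k) d 1≤k 1≤d) c-large
  linkage : Linkage (deleteAll e (adj D)) (proj₂ ∘ e) (cyclicTails D e ∘ suc)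
  linkage = edmonds-linkage (deleteAll e (adj D)) (proj₂ ∘ e) (cyclicTails D e ∘ suc)
                            (edmonds-after-deletion D e 2k≤c connected (proj₂ ∘ e))
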